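{- Let $\Delta$ be a bi-transitive bipartite digraph in which no two symmetric edges have a common endpoint. Then $\Delta$ has no directed circuit of length $\ge 4$.
   Context: Digraphs have no loops or multiple edges. A bipartite digraph has two colour classes with every edge joining different classes; it is bi-transitive if whenever $u_1v_1,v_1u_2,u_2v_2$ are edges, $u_1v_2$ is an edge. A symmetric edge is an unordered pair $\{u,v\}$ such that both $uv$ and $vu$ are edges. A directed trail is a directed walk $u_0\to u_1\to\cdots\to u_k$ (each $u_iu_{i+1}$ an edge) with all edges distinct, its length being $k$; a directed circuit is a non-empty directed trail whose first and last vertices coincide. -}

module Defs where

open import Data.Nat using (ℕ; suc; _≥_)
open import Data.Fin using (Fin; inject₁) renaming (suc to fsuc)
open import Data.Fin using () renaming (zero to fzero)
open import Data.Bool using (Bool)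
open import Data.Product using (_×_; _,_; Σ)
open import Relation.Binary.PropositionalEquality using (_≡_; _≢_)
open import Relation.Nullary using (¬_)

record Digraph (n : ℕ) : Set₁ where
  field
    Edge    : Fin n → Fin n → Set
    noLoops : ∀ v → ¬ Edge v v
open Digraph public

record BipartiteDigraph (n : ℕ) : Set₁ where
  field
    graph   : Digraph n
    colour  : Fin n → Bool
    proper  : ∀ u v → Edge graph u v → colour u ≢ colour v
open BipartiteDigraph public

BiTransitive : ∀ {n} → Digraph n → Set
BiTransitive G = ∀ u₁ v₁ u₂ v₂ →
  Edge G u₁ v₁ → Edge G v₁ u₂ → Edge G u₂ v₂ → Edge G u₁ v₂

SymEdge : ∀ {n} → Digraph n → Fin n → Fin n → Set
SymEdge G u v = Edge G u v × Edge G v u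

-- No two (distinct) symmetric edges share an endpoint: if {u,v} and {u,w}
-- are symmetric edges then v = w (so the two edges coincide).
NoAdjacentSymEdges : ∀ {n} → Digraph n → Set
NoAdjacentSymEdges G = ∀ u v w → SymEdge G u v → SymEdge G u w → v ≡ w

IsDirectedWalk : ∀ {n} → Digraph n → (k : ℕ) → (Fin (suc k) → Fin n) → Set
IsDirectedWalk G k w = ∀ (i : Fin k) → Edge G (w (inject₁ i)) (w (fsuc i))

IsDirectedTrail : ∀ {n} → Digraph n → (k : ℕ) → (Fin (suc k) → Fin n) → Set
IsDirectedTrail G k w =
  IsDirectedWalk G k w ×
  (∀ (i j : Fin k) →
     w (inject₁ i) ≡ w (inject₁ j) → w (fsuc i) ≡ w (fsuc j) → i ≡ j)

last : (k : ℕ) → Fin (suc k)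
last ℕ.zero = fzero
last (suc k) = fsuc (last k)

IsDirectedCircuit : ∀ {n} → Digraph n → (k : ℕ) → (Fin (suc k) → Fin n) → Set
IsDirectedCircuit G k w =
  k ≥ 1 × IsDirectedTrail G k w × w fzero ≡ w (last k)

module Submission where

open import Defs
open import Data.Nat using (ℕ; zero; suc; _*_; _≥_; s≤s)
open import Data.Fin using (Fin) renaming (suc to fsuc; zero to fzero)
open import Data.Product using (_×_; _,_; ∃)
open import Data.Sum using (_⊎_; inj₁; inj₂)
open import Function using (_∘_)
open import Relation.Nullary using (¬_)
open import Relation.Binary.PropositionalEquality using (_≡_; refl; sym; cong; subst)

-- Bi-transitivity shortcuts any walk of odd length to a single edge. On a
-- circuit of odd length this produces a loop. On a circuit w₀ w₁ w₂ w₃ … w₀ of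
-- even length ≥ 4 the odd part w₃ … w₀ shortcuts to an edge w₃w₀, so w₀w₁w₂w₃
-- is a directed 4-cycle; bi-transitivity makes all its edges symmetric, and
-- then the hypothesis on symmetric edges forces w₀ = w₂ and w₁ = w₃, so the
-- circuit traverses the edge w₀w₁ twice.

even-or-odd : ∀ k → (∃ λ j → k ≡ j * 2) ⊎ (∃ λ j → k ≡ suc (j * 2))
even-or-odd zero = inj₁ (0 , refl)
even-or-odd (suc k) with even-or-odd k
... | inj₁ (j , k≡2j) = inj₂ (j , cong suc k≡2j)
... | inj₂ (j , k≡2j+1) = inj₁ (suc j , cong suc k≡2j+1)

module _ {n} (G : Digraph n) (bt : BiTransitive G) where

  oddWalk⇒edge : ∀ j (w : Fin (suc (suc (j * 2))) → Fin n) →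
    IsDirectedWalk G (suc (j * 2)) w → Edge G (w fzero) (w (last (suc (j * 2))))
  oddWalk⇒edge zero    w walk = walk fzero
  oddWalk⇒edge (suc j) w walk =
    bt _ _ _ _ (walk fzero) (walk (fsuc fzero))
      (oddWalk⇒edge j (w ∘ fsuc ∘ fsuc) (λ i → walk (fsuc (fsuc i))))

  fourCycle-collapses : NoAdjacentSymEdges G →
    ∀ {a b c d} → Edge G a b → Edge G b c → Edge G c d → Edge G d a →
    a ≡ c × b ≡ d
  fourCycle-collapses na {a} {b} {c} {d} ab bc cd da =
    na b a c (ba , ab) (bc , cb) , na c b d (cb , bc) (cd , dc)
    where
    ba : Edge G b a
    ba = bt b c d a bc cd da
    cb : Edge G c b
    cb = bt c d a b cd da ab
    dc : Edge G d c
    dc = bt d a b c da ab bc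

lemma5 : ∀ {n} (Δ : BipartiteDigraph n) →
    BiTransitive (graph Δ) →
    NoAdjacentSymEdges (graph Δ) →
    ∀ (k : ℕ) (w : Fin (suc k) → Fin n) →
    k ≥ 4 → ¬ IsDirectedCircuit (graph Δ) k w
lemma5 Δ bt na k w _ (_ , (walk , distinct) , closed) with even-or-odd k
... | inj₂ (j , refl) =
  noLoops (graph Δ) (w fzero)
    (subst (Edge (graph Δ) (w fzero)) (sym closed) (oddWalk⇒edge (graph Δ) bt j w walk))
lemma5 Δ bt na _ w (s≤s (s≤s (s≤s (s≤s _)))) (_ , (walk , distinct) , closed)
  | inj₁ (suc (suc m) , refl)
  with fourCycle-collapses (graph Δ) bt na
         (walk fzero) (walk (fsuc fzero)) (walk (fsuc (fsuc fzero))) w₃w₀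
  where
  w₃w₀ : Edge (graph Δ) (w (fsuc (fsuc (fsuc fzero)))) (w fzero)
  w₃w₀ = subst (Edge (graph Δ) _) (sym closed)
    (oddWalk⇒edge (graph Δ) bt m (w ∘ fsuc ∘ fsuc ∘ fsuc) (λ i → walk (fsuc (fsuc (fsuc i)))))
... | w₀≡w₂ , w₁≡w₃ with distinct fzero (fsuc (fsuc fzero)) w₀≡w₂ w₁≡w₃
... | ()
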